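{- Let $k\ge 3$. The only straddling palindrome of $W^{(k)}_{2k-1}$ is the factor $kk$ (i.e. there is exactly one straddling palindrome, and it is the two-letter word $kk$).
   Context: The alphabet is $\mathbb{N}=\{0,1,2,\dots\}$. For an integer $k\ge 3$, $\varphi_k$ is the morphism of $\mathbb{N}^*$ defined on letters, for $i\ge 0$ and $0\le j\le k-1$, by $\varphi_k(ki+j)=(ki)(ki+j+1)$ (two letters) if $0\le j\le k-2$, and $\varphi_k(ki+k-1)=(ki+k)$ (one letter). For $n\ge 0$, $W^{(k)}_n=\varphi_k^n(0)$; for $W=w_1\cdots w_m$, $W[s,t]=w_s\cdots w_t$. For $n\ge k$ let $e=\sum_{i=n-k+1}^{n-1}|W^{(k)}_i|$ (the length of the part $W^{(k)}_{n-1}\cdots W^{(k)}_{n-k+1}$ preceding the final block $k\oplus W^{(k)}_{n-k}$ of $W^{(k)}_n$, where $k\oplus W$ adds $k$ to every letter of $W$). A straddling palindrome of $W^{(k)}_n$ is a pair $(s,t)$ with $1\le s\le e<t\le|W^{(k)}_n|$ such that $W^{(k)}_n[s,t]$ is a palindrome. -}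

module Defs where

open import Data.Nat using (ℕ; zero; suc; _+_; _*_; _∸_; _<_; _<ᵇ_)
open import Data.Nat.DivMod using (_/_; _%_)
open import Data.List using (List; []; _∷_; concatMap; length; drop; take; reverse)
open import Data.Bool using (if_then_else_)
open import Relation.Binary.PropositionalEquality using (_≡_)

-- The morphism φ_k on a single letter a = k*i + j (i = a / k, j = a % k):
--   φ_k(ki+j) = (ki)(ki+j+1)   if j ≤ k-2, i.e. j+1 < k
--   φ_k(ki+k-1) = (ki+k)
-- (The case k = 0 is irrelevant, since the theorem assumes k ≥ 3.)
φ-letter : ℕ → ℕ → List ℕ
φ-letter zero a = a ∷ []
φ-letter (suc m) a =
  let k = suc m
      i = a / k
      j = a % k
  in if suc j <ᵇ k
     then (k * i) ∷ (k * i + suc j) ∷ []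
     else (k * i + k) ∷ []

φ : ℕ → List ℕ → List ℕ
φ k w = concatMap (φ-letter k) w

φ^ : ℕ → ℕ → List ℕ → List ℕ
φ^ k zero w = w
φ^ k (suc n) w = φ k (φ^ k n w)

W : ℕ → ℕ → List ℕ
W k n = φ^ k n (0 ∷ [])

-- sum_{i = a}^{b} f i  (empty when b < a); here written as sum over i = a .. a+c-1
sumFrom : ℕ → ℕ → (ℕ → ℕ) → ℕ
sumFrom a zero f = 0
sumFrom a (suc c) f = f a + sumFrom (suc a) c f

-- e = sum_{i=n-k+1}^{n-1} |W^{(k)}_i|   (k-1 terms, for n ≥ k)
e : ℕ → ℕ → ℕ
e k n = sumFrom (suc (n ∸ k)) (k ∸ 1) (λ i → length (W k i))

-- W[s,t] = w_s ⋯ w_t  (1-indexed, inclusive)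
factor : List ℕ → ℕ → ℕ → List ℕ
factor w s t = take (suc t ∸ s) (drop (s ∸ 1) w)

Palindrome : List ℕ → Set
Palindrome u = reverse u ≡ u

StraddlingPal : ℕ → ℕ → ℕ → ℕ → Set
StraddlingPal k n s t =
  (1 Data.Nat.≤ s) × (s Data.Nat.≤ e k n) × (e k n < t) × (t Data.Nat.≤ length (W k n))
  × Palindrome (factor (W k n) s t)
  where open import Data.Product using (_×_)

module Submission where

-- The recurrence W_{k+n} = W_{k+n-1} ⋯ W_{n+1} (k ⊕ W_n) splits W_{2k-1} at e into a
-- prefix ending in 0 1 k and the block k ⊕ W_{k-1} = k v, all of whose letters are ≥ k.
-- Neither part contains the square k k: no image under φ_k contains 0 0, so no shifted
-- block k ⊕ W_n contains k k; and, by strong induction, every W_i with i ≤ 2k-2 is kk-free,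
-- being either a word over letters < k or, by the recurrence, a product of earlier kk-free
-- words beginning with 0, followed by W_{n+1} (letters < k) and a shifted block.  So a
-- straddling palindrome contains exactly one occurrence of k k.  A palindrome with a
-- unique occurrence of a square is centred on it, and this one cannot extend beyond it,
-- as that would place the letter 1 preceding the square opposite a letter of v.

open import Defs
open import Data.Nat using (NonZero; ℕ; zero; suc; z<s; _<?_; _+_; _*_; _∸_; _<ᵇ_; _≤_; _<_; z≤n; s≤s; s≤s⁻¹)
open import Data.Nat.Properties
open import Data.Nat.DivMod using (_/_; _%_; m<n⇒m/n≡0; m<n⇒m%n≡m; [m+n]%n≡m%n; +-distrib-/-∣ˡ; n/n≡1)
open import Data.Nat.Divisibility using (∣-refl)
open import Data.Nat.Induction using (<-rec)
open import Data.Bool using (true; false; if_then_else_)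
open import Data.Bool.Properties using (T-≡; ¬-not)
open import Data.List using (List; []; _∷_; concatMap; _++_; _∷ʳ_; map; length; take; drop; reverse)
open import Data.List.Properties using (++-identityʳ; concatMap-++; concatMap-map; concatMap-cong; map-concatMap; ++-assoc; ∷ʳ-++; length-++; length-drop; length-take; drop-all; drop-[]; reverse-++; unfold-reverse; reverse-involutive; ∷-injectiveˡ; ∷-injectiveʳ)
open import Data.List.Relation.Unary.All as All using (All; []; _∷_)
open import Data.List.Relation.Unary.All.Properties using (take⁺; ++⁺; map⁺)
open import Data.Product using (∃; Σ; _×_; _,_)
open import Data.Empty using (⊥-elim)
open import Function using (_∘_; _∘′_)
open import Function.Bundles using (_⇔_; mk⇔; Equivalence)
open import Relation.Nullary using (¬_; yes; no)
open import Relation.Binary.PropositionalEquality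

data HasSquare (c : ℕ) : List ℕ → Set where
  here  : ∀ {x y xs} → x ≡ c → y ≡ c → HasSquare c (x ∷ y ∷ xs)
  there : ∀ {x xs} → HasSquare c xs → HasSquare c (x ∷ xs)

SquareFree : ℕ → List ℕ → Set
SquareFree c w = ¬ HasSquare c w

HasSquare-∷⁻ : ∀ {c x xs} → x ≢ c → HasSquare c (x ∷ xs) → HasSquare c xs
HasSquare-∷⁻ x≢c (here x≡c _) = ⊥-elim (x≢c x≡c)
HasSquare-∷⁻ _   (there h)    = h

HasSquare-++⁺ʳ : ∀ {c} xs {ys} → HasSquare c ys → HasSquare c (xs ++ ys)
HasSquare-++⁺ʳ []       h = h
HasSquare-++⁺ʳ (_ ∷ xs) h = there (HasSquare-++⁺ʳ xs h)

HasSquare-++⁻ʳ : ∀ {c} xs {ys} → All (_≢ c) xs → HasSquare c (xs ++ ys) → HasSquare c ys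
HasSquare-++⁻ʳ []       []           h = h
HasSquare-++⁻ʳ (_ ∷ xs) (x≢c ∷ xs≢c) h = HasSquare-++⁻ʳ xs xs≢c (HasSquare-∷⁻ x≢c h)

SquareFree-avoiding : ∀ {c xs} → All (_≢ c) xs → SquareFree c xs
SquareFree-avoiding (x≢c ∷ _)  (here x≡c _) = x≢c x≡c
SquareFree-avoiding (_ ∷ xs≢c) (there h)    = SquareFree-avoiding xs≢c h

HasSquare-drop⁻ : ∀ {c} n xs → HasSquare c (drop n xs) → HasSquare c xs
HasSquare-drop⁻ zero    xs       h = h
HasSquare-drop⁻ (suc n) (_ ∷ xs) h = there (HasSquare-drop⁻ n xs h)

HasSquare-take⁻ : ∀ {c} n xs → HasSquare c (take n xs) → HasSquare c xs
HasSquare-take⁻ (suc (suc n)) (_ ∷ _ ∷ _) (here x≡c y≡c) = here x≡c y≡c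
HasSquare-take⁻ (suc n)       (_ ∷ xs)    (there h)      = there (HasSquare-take⁻ n xs h)

HasSquare-map⁻ : ∀ {c} n xs → HasSquare (n + c) (map (n +_) xs) → HasSquare c xs
HasSquare-map⁻ n (x ∷ y ∷ xs) (here p q) = here (+-cancelˡ-≡ n x _ p) (+-cancelˡ-≡ n y _ q)
HasSquare-map⁻ n (x ∷ xs)     (there h)  = there (HasSquare-map⁻ n xs h)

SquareFree-++ : ∀ {c y} xs {ys} → y ≢ c →
                SquareFree c xs → SquareFree c (y ∷ ys) → SquareFree c (xs ++ y ∷ ys)
SquareFree-++ []            _   _   sf₂ h              = sf₂ h
SquareFree-++ (_ ∷ [])      y≢c _   _   (here _ y≡c)   = y≢c y≡c
SquareFree-++ (_ ∷ [])      _   _   sf₂ (there h)      = sf₂ h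
SquareFree-++ (_ ∷ _ ∷ _)   _   sf₁ _   (here p q)     = sf₁ (here p q)
SquareFree-++ (_ ∷ x ∷ xs)  y≢c sf₁ sf₂ (there h)      = SquareFree-++ (x ∷ xs) y≢c (sf₁ ∘ there) sf₂ h

square-unique : ∀ {a} B B' {C C'} → SquareFree a (B ∷ʳ a) → SquareFree a (a ∷ C) →
                B ++ a ∷ a ∷ C ≡ B' ++ a ∷ a ∷ C' → B ≡ B'
square-unique []          []       _   _   _  = refl
square-unique []          (_ ∷ B') _   sfC eq =
  ⊥-elim (sfC (subst (HasSquare _) (sym (∷-injectiveʳ eq)) (HasSquare-++⁺ʳ B' (here refl refl))))
square-unique (_ ∷ [])    []       sfB _   eq = ⊥-elim (sfB (here (∷-injectiveˡ eq) refl))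
square-unique (_ ∷ _ ∷ _) []       sfB _   eq =
  ⊥-elim (sfB (here (∷-injectiveˡ eq) (∷-injectiveˡ (∷-injectiveʳ eq))))
square-unique (_ ∷ B)     (_ ∷ B') sfB sfC eq =
  cong₂ _∷_ (∷-injectiveˡ eq) (square-unique B B' (sfB ∘ there) sfC (∷-injectiveʳ eq))

reverse-++-∷ : ∀ (xs : List ℕ) y ys → reverse (xs ++ y ∷ ys) ≡ reverse ys ++ y ∷ reverse xs
reverse-++-∷ xs y ys = begin
  reverse (xs ++ y ∷ ys)          ≡⟨ reverse-++ xs (y ∷ ys) ⟩
  reverse (y ∷ ys) ++ reverse xs  ≡⟨ cong (_++ reverse xs) (unfold-reverse y ys) ⟩
  reverse ys ∷ʳ y ++ reverse xs   ≡⟨ ∷ʳ-++ (reverse ys) y (reverse xs) ⟩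
  reverse ys ++ y ∷ reverse xs    ∎
  where open ≡-Reasoning

drop-++ : ∀ n (xs ys : List ℕ) → n ≤ length xs → drop n (xs ++ ys) ≡ drop n xs ++ ys
drop-++ zero    xs       ys _       = refl
drop-++ (suc n) (x ∷ xs) ys (s≤s p) = drop-++ n xs ys p

take-length-++ : ∀ (xs : List ℕ) n ys → take (length xs + n) (xs ++ ys) ≡ xs ++ take n ys
take-length-++ []       n ys = refl
take-length-++ (x ∷ xs) n ys = cong (x ∷_) (take-length-++ xs n ys)

drop-∷ʳ-avoiding : ∀ {b : ℕ} n xs → All (b ≢_) (reverse (drop n (xs ∷ʳ b))) → drop n (xs ∷ʳ b) ≡ []
drop-∷ʳ-avoiding zero    xs       b∉ with b≢b ∷ _ ← subst (All _) (reverse-++ xs _) b∉ = ⊥-elim (b≢b refl)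
drop-∷ʳ-avoiding (suc n) []       _  = drop-[] n
drop-∷ʳ-avoiding (suc n) (_ ∷ xs) b∉ = drop-∷ʳ-avoiding n xs b∉

factor-++ : ∀ (xs ys : List ℕ) s d → s ≤ length xs →
            factor (xs ++ ys) (suc s) (length xs + d) ≡ drop s xs ++ take d ys
factor-++ xs ys s d s≤ = begin
  take (length xs + d ∸ s) (drop s (xs ++ ys))     ≡⟨ cong₂ take (+-∸-comm d s≤) (drop-++ s xs ys s≤) ⟩
  take (length xs ∸ s + d) (drop s xs ++ ys)       ≡⟨ cong (λ n → take (n + d) (drop s xs ++ ys)) (sym (length-drop s xs)) ⟩
  take (length (drop s xs) + d) (drop s xs ++ ys)  ≡⟨ take-length-++ (drop s xs) d ys ⟩
  drop s xs ++ take d ys                           ∎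
  where open ≡-Reasoning

length-∷ʳ : ∀ (xs : List ℕ) x → length (xs ∷ʳ x) ≡ suc (length xs)
length-∷ʳ xs x = trans (length-++ xs) (+-comm (length xs) 1)

PalindromeAcross : List ℕ → ℕ → ℕ → ℕ → Set
PalindromeAcross w ε s t = 1 ≤ s × s ≤ ε × ε < t × t ≤ length w × Palindrome (factor w s t)

UniqueStraddlingPalindrome : List ℕ → ℕ → List ℕ → Set
UniqueStraddlingPalindrome w ε x = Σ ℕ λ s₀ → Σ ℕ λ t₀ →
  ((s t : ℕ) → PalindromeAcross w ε s t ⇔ (s ≡ s₀ × t ≡ t₀)) × factor w s₀ t₀ ≡ x

module StraddlingSquare {a b : ℕ} (p v : List ℕ) (b∉v : All (b ≢_) v)
                        (sf-u : SquareFree a (p ∷ʳ b ∷ʳ a)) (sf-v : SquareFree a (a ∷ v)) where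
  q u w : List ℕ
  q = p ∷ʳ b
  u = q ∷ʳ a
  w = u ++ a ∷ v

  ε : ℕ
  ε = length u

  ε≡ : ε ≡ suc (length q)
  ε≡ = length-∷ʳ q a

  centred : ∀ s d → suc s ≤ ε → suc ε + d ≤ length w →
            Palindrome (factor w (suc s) (suc ε + d)) → s ≡ length q × d ≡ 0
  centred s d s<ε t≤w pal = s≡ , d≡
    where
    open ≡-Reasoning
    s≤q : s ≤ length q
    s≤q = s≤s⁻¹ (subst (suc s ≤_) ε≡ s<ε)
    d≤v : d ≤ length v
    d≤v = s≤s⁻¹ (+-cancelˡ-≤ ε _ _ (subst₂ _≤_ (sym (+-suc ε d)) (length-++ u) t≤w))
    B C : List ℕ
    B = drop s q
    C = take d v
    drop-u : drop s u ≡ B ∷ʳ a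
    drop-u = drop-++ s q (a ∷ []) s≤q
    F≡ : factor w (suc s) (suc ε + d) ≡ B ++ a ∷ a ∷ C
    F≡ = begin
      factor w (suc s) (suc ε + d)  ≡⟨ cong (factor w (suc s)) (+-suc ε d) ⟨
      factor w (suc s) (ε + suc d)  ≡⟨ factor-++ u (a ∷ v) s (suc d) (≤-trans (n≤1+n s) s<ε) ⟩
      drop s u ++ a ∷ C             ≡⟨ cong (_++ a ∷ C) drop-u ⟩
      B ∷ʳ a ++ a ∷ C               ≡⟨ ∷ʳ-++ B a (a ∷ C) ⟩
      B ++ a ∷ a ∷ C                ∎
    mirror : B ++ a ∷ a ∷ C ≡ reverse C ++ a ∷ a ∷ reverse B
    mirror = begin
      B ++ a ∷ a ∷ C                   ≡⟨ trans (sym F≡) (trans (sym pal) (cong reverse F≡)) ⟩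
      reverse (B ++ a ∷ a ∷ C)         ≡⟨ reverse-++-∷ B a (a ∷ C) ⟩
      reverse (a ∷ C) ++ a ∷ reverse B ≡⟨ cong (_++ a ∷ reverse B) (unfold-reverse a C) ⟩
      reverse C ∷ʳ a ++ a ∷ reverse B  ≡⟨ ∷ʳ-++ (reverse C) a (a ∷ reverse B) ⟩
      reverse C ++ a ∷ a ∷ reverse B   ∎
    B≡ : B ≡ reverse C
    B≡ = square-unique B (reverse C)
           (sf-u ∘ HasSquare-drop⁻ s u ∘ subst (HasSquare a) (sym drop-u))
           (sf-v ∘ HasSquare-take⁻ (suc d) (a ∷ v))
           mirror
    C≡ : C ≡ reverse B
    C≡ = trans (sym (reverse-involutive C)) (cong reverse (sym B≡))
    -- C avoids b, so its mirror image B cannot contain the letter b that ends every nonempty suffix of q.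
    B≡[] : B ≡ []
    B≡[] = drop-∷ʳ-avoiding s p (subst (All (b ≢_)) C≡ (take⁺ d b∉v))
    s≡ : s ≡ length q
    s≡ = ≤-antisym s≤q (m∸n≡0⇒m≤n (trans (sym (length-drop s q)) (cong length B≡[])))
    d≡ : d ≡ 0
    d≡ = trans (sym (m≤n⇒m⊓n≡m d≤v)) (trans (sym (length-take d v)) (cong length (trans C≡ (cong reverse B≡[]))))

  forward : ∀ s t → PalindromeAcross w ε s t → s ≡ ε × t ≡ suc ε
  forward (suc s) t (_ , s<ε , ε<t , t≤w , pal) with d , refl ← m≤n⇒∃[o]m+o≡n ε<t
    with s≡q , d≡0 ← centred s d s<ε t≤w pal =
      trans (cong suc s≡q) (sym ε≡) , cong suc (trans (cong (ε +_) d≡0) (+-identityʳ ε))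

  square : factor w ε (suc ε) ≡ a ∷ a ∷ []
  square = begin
    factor w ε (suc ε)                    ≡⟨ cong₂ (factor w) ε≡ (+-comm 1 ε) ⟩
    factor w (suc (length q)) (ε + 1)     ≡⟨ factor-++ u (a ∷ v) (length q) 1 (subst (length q ≤_) (sym ε≡) (n≤1+n _)) ⟩
    drop (length q) u ++ a ∷ []           ≡⟨ cong (_++ a ∷ []) (drop-++ (length q) q (a ∷ []) ≤-refl) ⟩
    drop (length q) q ∷ʳ a ++ a ∷ []      ≡⟨ cong (λ z → z ∷ʳ a ++ a ∷ []) (drop-all (length q) q ≤-refl) ⟩
    a ∷ a ∷ []                            ∎
    where open ≡-Reasoning

  backward : ∀ s t → s ≡ ε × t ≡ suc ε → PalindromeAcross w ε s t
  backward s t (refl , refl) =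
    subst (1 ≤_) (sym ε≡) (s≤s z≤n) , ≤-refl , ≤-refl ,
    subst (suc ε ≤_) (sym (trans (length-++ u) (+-suc ε _))) (s≤s (m≤m+n ε _)) ,
    subst Palindrome (sym square) refl

  unique : UniqueStraddlingPalindrome w ε (a ∷ a ∷ [])
  unique = ε , suc ε , (λ s t → mk⇔ (forward s t) (backward s t)) , square

<ᵇ-true : ∀ {a b} → a < b → (a <ᵇ b) ≡ true
<ᵇ-true a<b = Equivalence.to T-≡ (<⇒<ᵇ a<b)

<ᵇ-false : ∀ {a b} → b ≤ a → (a <ᵇ b) ≡ false
<ᵇ-false b≤a = ¬-not (λ a<ᵇb → ≤⇒≯ b≤a (<ᵇ⇒< _ _ (Equivalence.from T-≡ a<ᵇb)))

φ-letter-by-divMod : ∀ m a {i j} → a / suc m ≡ i → a % suc m ≡ j →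
  φ-letter (suc m) a ≡ (if suc j <ᵇ suc m then suc m * i ∷ suc m * i + suc j ∷ [] else suc m * i + suc m ∷ [])
φ-letter-by-divMod m a refl refl = refl

φ-letter-small : ∀ {k j} → suc j < k → φ-letter k j ≡ 0 ∷ suc j ∷ []
φ-letter-small {suc m} {j} j+1<k@(s≤s j<k)
  rewrite φ-letter-by-divMod m j (m<n⇒m/n≡0 (m≤n⇒m≤1+n j<k)) (m<n⇒m%n≡m (m≤n⇒m≤1+n j<k))
        | <ᵇ-true j+1<k | *-zeroʳ m = refl

φ-letter-last : ∀ m → φ-letter (suc m) m ≡ suc m ∷ []
φ-letter-last m
  rewrite φ-letter-by-divMod m m (m<n⇒m/n≡0 (n<1+n m)) (m<n⇒m%n≡m (n<1+n m)) | <ᵇ-false (≤-refl {suc m}) | *-zeroʳ m = refl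

[n+m]/n≡1+m/n : ∀ n m .{{_ : NonZero n}} → (n + m) / n ≡ suc (m / n)
[n+m]/n≡1+m/n n m = trans (+-distrib-/-∣ˡ m ∣-refl) (cong (_+ m / n) (n/n≡1 n))

[n+m]%n≡m%n : ∀ n m .{{_ : NonZero n}} → (n + m) % n ≡ m % n
[n+m]%n≡m%n n m = trans (cong (_% n) (+-comm n m)) ([m+n]%n≡m%n m n)

φ-letter-shift : ∀ k a → φ-letter k (k + a) ≡ map (k +_) (φ-letter k a)
φ-letter-shift zero    a = refl
φ-letter-shift (suc m) a
  rewrite φ-letter-by-divMod m (suc m + a) ([n+m]/n≡1+m/n (suc m) a) ([n+m]%n≡m%n (suc m) a) | φ-letter-by-divMod m a refl refl
  with suc (a % suc m) <ᵇ suc m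
... | true  = cong₂ (λ x y → x ∷ y ∷ []) (*-suc (suc m) _) (shifted (suc (a % suc m)))
  where
  shifted : ∀ r → suc m * suc (a / suc m) + r ≡ suc m + (suc m * (a / suc m) + r)
  shifted r = trans (cong (_+ r) (*-suc (suc m) _)) (+-assoc (suc m) _ r)
... | false = cong (_∷ []) (trans (cong (_+ suc m) (*-suc (suc m) _)) (+-assoc (suc m) _ (suc m)))

φ-letter-++-squareFree₀ : ∀ m a {rest} → SquareFree 0 rest → SquareFree 0 (φ-letter (suc m) a ++ rest)
φ-letter-++-squareFree₀ m a sf rewrite φ-letter-by-divMod m a refl refl with suc (a % suc m) <ᵇ suc m
... | true  = λ { (here _ y≡0) → m+1+n≢0 _ y≡0 ; (there h) → sf (HasSquare-∷⁻ (m+1+n≢0 _) h) }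
... | false = sf ∘ HasSquare-∷⁻ (m+1+n≢0 _)

φ-squareFree₀ : ∀ m w → SquareFree 0 (φ (suc m) w)
φ-squareFree₀ m []      = λ ()
φ-squareFree₀ m (a ∷ w) = φ-letter-++-squareFree₀ m a (φ-squareFree₀ m w)

φ-++ : ∀ k u v → φ k (u ++ v) ≡ φ k u ++ φ k v
φ-++ k = concatMap-++ (φ-letter k)

φ-shift : ∀ k w → φ k (map (k +_) w) ≡ map (k +_) (φ k w)
φ-shift k w = begin
  concatMap (φ-letter k) (map (k +_) w)     ≡⟨ concatMap-map (φ-letter k) (k +_) w ⟩
  concatMap (φ-letter k ∘′ (k +_)) w        ≡⟨ concatMap-cong (φ-letter-shift k) w ⟩
  concatMap (map (k +_) ∘′ φ-letter k) w    ≡⟨ sym (map-concatMap (k +_) (φ-letter k) w) ⟩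
  map (k +_) (concatMap (φ-letter k) w)     ∎
  where open ≡-Reasoning

φ^-++ : ∀ k n u v → φ^ k n (u ++ v) ≡ φ^ k n u ++ φ^ k n v
φ^-++ k zero    u v = refl
φ^-++ k (suc n) u v = trans (cong (φ k) (φ^-++ k n u v)) (φ-++ k (φ^ k n u) _)

φ^-shift : ∀ k n w → φ^ k n (map (k +_) w) ≡ map (k +_) (φ^ k n w)
φ^-shift k zero    w = refl
φ^-shift k (suc n) w = trans (cong (φ k) (φ^-shift k n w)) (φ-shift k (φ^ k n w))

φ^-suc : ∀ k n w → φ^ k (suc n) w ≡ φ^ k n (φ k w)
φ^-suc k zero    w = refl
φ^-suc k (suc n) w = cong (φ k) (φ^-suc k n w)

module Words (m : ℕ) where
  k : ℕ
  k = suc m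

  φⁿ : ℕ → ℕ → List ℕ
  φⁿ n a = φ^ k n (a ∷ [])

  φⁿ-suc-small : ∀ n j → suc j < k → φⁿ (suc n) j ≡ W k n ++ φⁿ n (suc j)
  φⁿ-suc-small n j j+1<k = begin
    φ^ k (suc n) (j ∷ [])    ≡⟨ φ^-suc k n (j ∷ []) ⟩
    φ^ k n (φ k (j ∷ []))    ≡⟨ cong (φ^ k n) (trans (++-identityʳ _) (φ-letter-small j+1<k)) ⟩
    φ^ k n (0 ∷ suc j ∷ [])  ≡⟨ φ^-++ k n (0 ∷ []) (suc j ∷ []) ⟩
    W k n ++ φⁿ n (suc j)    ∎
    where open ≡-Reasoning

  φⁿ-suc-last : ∀ n → φⁿ (suc n) m ≡ map (k +_) (W k n)
  φⁿ-suc-last n = begin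
    φ^ k (suc n) (m ∷ [])          ≡⟨ φ^-suc k n (m ∷ []) ⟩
    φ^ k n (φ k (m ∷ []))          ≡⟨ cong (φ^ k n) (trans (++-identityʳ _) (φ-letter-last m)) ⟩
    φ^ k n (k ∷ [])                ≡⟨ cong (λ x → φ^ k n (x ∷ [])) (sym (+-identityʳ k)) ⟩
    φ^ k n (map (k +_) (0 ∷ []))   ≡⟨ φ^-shift k n (0 ∷ []) ⟩
    map (k +_) (W k n)             ∎
    where open ≡-Reasoning

  blocks : ℕ → ℕ → List ℕ
  blocks N zero    = []
  blocks N (suc c) = blocks (suc N) c ++ W k N

  φⁿ-unfold : ∀ c N j → j + c < k → φⁿ (c + N) j ≡ blocks N c ++ φⁿ N (j + c)
  φⁿ-unfold zero    N j _      = cong (φⁿ N) (sym (+-identityʳ j))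
  φⁿ-unfold (suc c) N j j+c<k′ = begin
    φⁿ (suc c + N) j                                   ≡⟨ cong (λ n → φⁿ n j) (sym (+-suc c N)) ⟩
    φⁿ (c + suc N) j                                   ≡⟨ φⁿ-unfold c (suc N) j (<-trans (n<1+n _) j+c<k) ⟩
    blocks (suc N) c ++ φⁿ (suc N) (j + c)             ≡⟨ cong (blocks (suc N) c ++_) (φⁿ-suc-small N (j + c) j+c<k) ⟩
    blocks (suc N) c ++ (W k N ++ φⁿ N (suc (j + c)))  ≡⟨ sym (++-assoc (blocks (suc N) c) (W k N) _) ⟩
    blocks N (suc c) ++ φⁿ N (suc (j + c))             ≡⟨ cong (λ i → blocks N (suc c) ++ φⁿ N i) (sym (+-suc j c)) ⟩
    blocks N (suc c) ++ φⁿ N (j + suc c)               ∎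
    where
    open ≡-Reasoning
    j+c<k : suc (j + c) < k
    j+c<k = subst (_< k) (+-suc j c) j+c<k′

  W-recurrence : ∀ n → W k (k + n) ≡ blocks (suc n) m ++ map (k +_) (W k n)
  W-recurrence n = begin
    W k (k + n)                        ≡⟨ cong (W k) (sym (+-suc m n)) ⟩
    φⁿ (m + suc n) 0                   ≡⟨ φⁿ-unfold m (suc n) 0 ≤-refl ⟩
    blocks (suc n) m ++ φⁿ (suc n) m   ≡⟨ cong (blocks (suc n) m ++_) (φⁿ-suc-last n) ⟩
    blocks (suc n) m ++ map (k +_) (W k n) ∎
    where open ≡-Reasoning

  length-blocks : ∀ N c → length (blocks N c) ≡ sumFrom N c (λ i → length (W k i))
  length-blocks N zero    = refl
  length-blocks N (suc c) = begin
    length (blocks (suc N) c ++ W k N)          ≡⟨ length-++ (blocks (suc N) c) ⟩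
    length (blocks (suc N) c) + length (W k N)  ≡⟨ +-comm _ (length (W k N)) ⟩
    length (W k N) + length (blocks (suc N) c)  ≡⟨ cong (length (W k N) +_) (length-blocks (suc N) c) ⟩
    length (W k N) + sumFrom (suc N) c (λ i → length (W k i)) ∎
    where open ≡-Reasoning

  e≡length-blocks : ∀ n → e k (k + n) ≡ length (blocks (suc n) m)
  e≡length-blocks n =
    trans (cong (λ i → sumFrom (suc i) m (λ i → length (W k i))) (m+n∸m≡n k n)) (sym (length-blocks (suc n) m))

  φⁿ-letters< : ∀ n j → j + n < k → All (_< k) (φⁿ n j)
  φⁿ-letters< zero    j j<k     = subst (_< k) (+-identityʳ j) j<k ∷ []
  φⁿ-letters< (suc n) j j+n+1<k = subst (All (_< k)) (sym (φⁿ-suc-small n j (≤-<-trans (s≤s (m≤m+n j n)) j+1+n<k)))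
    (++⁺ (φⁿ-letters< n 0 (≤-<-trans (m≤n+m n j) (<-trans (n<1+n _) j+1+n<k))) (φⁿ-letters< n (suc j) j+1+n<k))
    where
    j+1+n<k : suc j + n < k
    j+1+n<k = subst (_< k) (+-suc j n) j+n+1<k

  W-squareFree₀ : ∀ n → SquareFree 0 (W k n)
  W-squareFree₀ zero    (there ())
  W-squareFree₀ (suc n) = φ-squareFree₀ m (W k n)

  shifted-squareFree : ∀ n → SquareFree k (map (k +_) (W k n))
  shifted-squareFree n = W-squareFree₀ n ∘ HasSquare-map⁻ k (W k n) ∘ subst (λ c → HasSquare c (map (k +_) (W k n))) (sym (+-identityʳ k))

module _ (m : ℕ) where
  open Words (suc m)

  W-head : ∀ n → ∃ λ ys → W k n ≡ 0 ∷ ys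
  W-head zero    = [] , refl
  W-head (suc n) with ys , eq ← W-head n =
    ys ++ φⁿ n 1 , trans (φⁿ-suc-small n 0 (s≤s (s≤s z≤n))) (cong (_++ φⁿ n 1) eq)

  ++W++-squareFree : ∀ xs n ys → SquareFree k xs → SquareFree k (W k n ++ ys) → SquareFree k (xs ++ W k n ++ ys)
  ++W++-squareFree xs n ys sf₁ sf₂ with zs , eq ← W-head n rewrite eq = SquareFree-++ xs (λ ()) sf₁ sf₂

  blocks-squareFree : ∀ N c → (∀ {j} → j < c + N → SquareFree k (W k j)) → SquareFree k (blocks N c)
  blocks-squareFree N zero    _  ()
  blocks-squareFree N (suc c) sf =
    subst (λ ws → SquareFree k (blocks (suc N) c ++ ws)) (++-identityʳ (W k N))
      (++W++-squareFree (blocks (suc N) c) N []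
        (blocks-squareFree (suc N) c (λ {j} j< → sf (subst (j <_) (+-suc c N) j<)))
        (subst (SquareFree k) (sym (++-identityʳ (W k N))) (sf (m<n+m N z<s))))

  W-squareFree-step : ∀ n → n < suc m → (∀ {j} → j < k + n → SquareFree k (W k j)) → SquareFree k (W k (k + n))
  W-squareFree-step n n<k-1 sf =
    subst (SquareFree k) (sym (trans (W-recurrence n) (++-assoc (blocks (2 + n) m) (W k (suc n)) _)))
      (++W++-squareFree (blocks (2 + n) m) (suc n) _
        (blocks-squareFree (2 + n) m (λ {j} j< → sf (subst (j <_) 2+n+m≡k+n j<)))
        (shifted-squareFree n ∘ HasSquare-++⁻ʳ (W k (suc n)) (All.map <⇒≢ (φⁿ-letters< (suc n) 0 (s≤s n<k-1)))))
    where
    2+n+m≡k+n : m + (2 + n) ≡ k + n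
    2+n+m≡k+n = trans (+-suc m (suc n)) (cong suc (+-suc m n))

  W-squareFree : ∀ i → i < k + suc m → SquareFree k (W k i)
  W-squareFree = <-rec _ step
    where
    step : ∀ i → (∀ {j} → j < i → j < k + suc m → SquareFree k (W k j)) → i < k + suc m → SquareFree k (W k i)
    step i ih i<bound with i <? k
    ... | yes i<k = SquareFree-avoiding (All.map <⇒≢ (φⁿ-letters< i 0 i<k))
    ... | no i≮k with n , refl ← m≤n⇒∃[o]m+o≡n (≮⇒≥ i≮k) =
      W-squareFree-step n (+-cancelˡ-< k n (suc m) i<bound) (λ j< → ih j< (<-trans j< i<bound))

  W-k-ends-01k : W k k ≡ blocks 2 m ∷ʳ 0 ∷ʳ 1 ∷ʳ k
  W-k-ends-01k = begin
    φⁿ (suc (suc m)) 0                    ≡⟨ cong (λ n → φⁿ (suc n) 0) (+-comm 1 m) ⟩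
    φⁿ (suc m + 1) 0                      ≡⟨ φⁿ-unfold (suc m) 1 0 ≤-refl ⟩
    (blocks 2 m ++ W k 1) ++ φⁿ 1 (suc m) ≡⟨ cong₂ (λ x y → (blocks 2 m ++ x) ++ y) (φⁿ-suc-small 0 0 (s≤s (s≤s z≤n)))
                                               (trans (φⁿ-suc-last 0) (cong (_∷ []) (+-identityʳ k))) ⟩
    (blocks 2 m ++ 0 ∷ 1 ∷ []) ∷ʳ k       ≡⟨ cong (_∷ʳ k) (sym (++-assoc (blocks 2 m) (0 ∷ []) (1 ∷ []))) ⟩
    blocks 2 m ∷ʳ 0 ∷ʳ 1 ∷ʳ k             ∎
    where open ≡-Reasoning

  blocks-ends-1k : blocks k (suc m) ≡ (blocks (suc k) m ++ (blocks 2 m ∷ʳ 0)) ∷ʳ 1 ∷ʳ k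
  blocks-ends-1k = begin
    blocks (suc k) m ++ W k k                               ≡⟨ cong (blocks (suc k) m ++_) W-k-ends-01k ⟩
    blocks (suc k) m ++ (blocks 2 m ∷ʳ 0 ∷ʳ 1 ∷ʳ k)         ≡⟨ ++-assoc (blocks (suc k) m) _ (k ∷ []) ⟨
    (blocks (suc k) m ++ (blocks 2 m ∷ʳ 0 ∷ʳ 1)) ∷ʳ k       ≡⟨ cong (_∷ʳ k) (++-assoc (blocks (suc k) m) _ (1 ∷ [])) ⟨
    (blocks (suc k) m ++ (blocks 2 m ∷ʳ 0)) ∷ʳ 1 ∷ʳ k       ∎
    where open ≡-Reasoning

  W[k+k-1]-straddling : UniqueStraddlingPalindrome (W k (k + suc m)) (e k (k + suc m)) (k ∷ k ∷ [])
  W[k+k-1]-straddling with ys , eq ← W-head (suc m) =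
    subst₂ (λ w ε → UniqueStraddlingPalindrome w ε (k ∷ k ∷ [])) (sym W≡) (sym e≡)
      (StraddlingSquare.unique p (map (k +_) ys) 1∉ sf-u sf-v)
    where
    p : List ℕ
    p = blocks (suc k) m ++ (blocks 2 m ∷ʳ 0)
    last-block : map (k +_) (W k (suc m)) ≡ k ∷ map (k +_) ys
    last-block = trans (cong (map (k +_)) eq) (cong (_∷ map (k +_) ys) (+-identityʳ k))
    W≡ : W k (k + suc m) ≡ (p ∷ʳ 1 ∷ʳ k) ++ k ∷ map (k +_) ys
    W≡ = trans (W-recurrence (suc m)) (cong₂ _++_ blocks-ends-1k last-block)
    e≡ : e k (k + suc m) ≡ length (p ∷ʳ 1 ∷ʳ k)
    e≡ = trans (e≡length-blocks (suc m)) (cong length blocks-ends-1k)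
    1∉ : All (1 ≢_) (map (k +_) ys)
    1∉ = map⁺ (All.universal (λ _ ()) ys)
    sf-u : SquareFree k (p ∷ʳ 1 ∷ʳ k)
    sf-u = subst (SquareFree k) blocks-ends-1k
             (blocks-squareFree k (suc m) (λ {j} j< → W-squareFree j (subst (j <_) (+-comm (suc m) k) j<)))
    sf-v : SquareFree k (k ∷ map (k +_) ys)
    sf-v = subst (SquareFree k) last-block (shifted-squareFree (suc m))

W[2k-1]-uniqueStraddlingPalindrome : ∀ k → 2 ≤ k →
  UniqueStraddlingPalindrome (W k (2 * k ∸ 1)) (e k (2 * k ∸ 1)) (k ∷ k ∷ [])
W[2k-1]-uniqueStraddlingPalindrome (suc (suc m)) _ =
  subst (λ n → UniqueStraddlingPalindrome (W k n) (e k n) (k ∷ k ∷ [])) index≡ (W[k+k-1]-straddling m)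
  where
  k : ℕ
  k = suc (suc m)
  index≡ : k + suc m ≡ 2 * k ∸ 1
  index≡ = cong suc (sym (trans (cong (m +_) (+-identityʳ k)) (+-suc m (suc m))))
W[2k-1]-uniqueStraddlingPalindrome (suc zero) (s≤s ())

lemma5p11 : (k : ℕ) → 3 ≤ k →
    Σ ℕ (λ s₀ → Σ ℕ (λ t₀ →
      ((s t : ℕ) → StraddlingPal k (2 * k ∸ 1) s t ⇔ (s ≡ s₀ × t ≡ t₀))
      × factor (W k (2 * k ∸ 1)) s₀ t₀ ≡ k ∷ k ∷ []))
lemma5p11 k 3≤k = W[2k-1]-uniqueStraddlingPalindrome k (≤-trans (n≤1+n 2) 3≤k)
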